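{- Let $G=(V,E)$ be a finite multigraph (multiple edges and loops allowed) and let $v\in V$. Assume that all vertices other than $v$ have degree at most $\Delta$, where $\Delta$ is a positive integer. Then for any vertex $u\neq v$ and any $c\in[0,1]$, \[ \sum_{P\in\mathcal{P}_{G,u,v}}\left(\frac{c}{\Delta}\right)^{|P|}\leq c. \]
   Context: $\mathcal{P}_{G,u,v}$ denotes the collection of (edge sets of) all paths in the multigraph $G$ from $u$ to $v$ (parallel edges give distinct paths), and $|P|$ is the number of edges of $P$. Degrees are counted with multiplicity.
   Formalization: The parameter c ranges over the rationals in $[0,1]$. -}

module Defs where

open import Data.Nat as ℕ using (ℕ; zero; suc)
open import Data.Fin using (Fin; _≟_)
open import Data.Product using (_×_; _,_; proj₁; proj₂)
open import Data.Bool using (Bool; true; false; _∧_; not; if_then_else_)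
open import Data.List using (List; []; _∷_; map; concatMap; foldr; upTo; filter; length)
open import Data.List.Base using (allFin)
open import Data.Integer using (+_)
open import Data.Rational using (ℚ; 0ℚ; 1ℚ; _+_; _*_; _/_)
open import Relation.Nullary.Decidable using (⌊_⌋)

-- A finite multigraph: vertex set Fin n, edge set Fin m, and each edge
-- has an (unordered) pair of endpoints.  A loop is an edge whose two
-- endpoints coincide.  Parallel edges are distinct elements of Fin m.
record Multigraph : Set where
  field
    n    : ℕ
    m    : ℕ
    ends : Fin m → Fin n × Fin n
open Multigraph public

sumℕ : List ℕ → ℕ
sumℕ = foldr ℕ._+_ 0

sumℚ : List ℚ → ℚ
sumℚ = foldr _+_ 0ℚ

𝟙 : Bool → ℕ
𝟙 true  = 1
𝟙 false = 0

-- degree with multiplicity: each edge contributes the number of its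
-- endpoint slots equal to w (so a loop at w contributes 2)
degree : (G : Multigraph) → Fin (n G) → ℕ
degree G w = sumℕ (map (λ e → 𝟙 ⌊ proj₁ (ends G e) ≟ w ⌋ ℕ.+ 𝟙 ⌊ proj₂ (ends G e) ≟ w ⌋) (allFin (m G)))

edgeSeqs : (G : Multigraph) → ℕ → List (List (Fin (m G)))
edgeSeqs G zero    = [] ∷ []
edgeSeqs G (suc k) = concatMap (λ e → map (e ∷_) (edgeSeqs G k)) (allFin (m G))

member : ∀ {k} → Fin k → List (Fin k) → Bool
member x []       = false
member x (y ∷ ys) = if ⌊ x ≟ y ⌋ then true else member x ys

isPathFrom : (G : Multigraph) → List (Fin (n G)) → Fin (n G) → List (Fin (m G)) → Fin (n G) → Bool
isPathFrom G visited x []       v = ⌊ x ≟ v ⌋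
isPathFrom G visited x (e ∷ es) v with ends G e
... | (a , b) =
  if ⌊ x ≟ a ⌋ then step b
  else if ⌊ x ≟ b ⌋ then step a
  else false
  where
    step : Fin (n G) → Bool
    step y = not (member y (x ∷ visited)) ∧ isPathFrom G (x ∷ visited) y es v

-- An edge sequence es is a path from u to v: the walk u = x₀, x₁, …, x_k = v
-- determined by es has pairwise distinct vertices.
isPath : (G : Multigraph) → Fin (n G) → Fin (n G) → List (Fin (m G)) → Bool
isPath G u v es = isPathFrom G [] u es v

-- 𝒫_{G,u,v}: all u–v paths (as edge sequences).  A path in a graph with
-- n vertices has at most n - 1 edges, so lengths 0..n cover all of them.
paths : (G : Multigraph) → Fin (n G) → Fin (n G) → List (List (Fin (m G)))
paths G u v = concatMap (λ k → filter (λ es → isPath G u v es Data.Bool.≟ true) (edgeSeqs G k)) (upTo (suc (n G)))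

_^ℚ_ : ℚ → ℕ → ℚ
q ^ℚ zero  = 1ℚ
q ^ℚ suc k = q * (q ^ℚ k)

pathSum : (G : Multigraph) → Fin (n G) → Fin (n G) → ℚ → ℚ
pathSum G u v x = sumℚ (map (λ P → x ^ℚ length P) (paths G u v))

{-# OPTIONS --safe #-}
-- Put weight X = c/Δ on every edge and let S_L(V, x) be the total weight of the paths from x to v
-- with fewer than L edges that avoid a set V of visited vertices.  From v only the empty path
-- survives, so S_{L+1}(V, v) = 1.  A path from x ≠ v starts with an edge at x and continues as a
-- path avoiding V ∪ {x}, so S_{L+1}(V, x) ≤ X · deg x · max S_L ≤ XΔ = c.  Hence every S_L is at
-- most 1 by induction on L, and S_{n+1}(∅, u) is the sum in the theorem.
module Submission where

open import Defs
open import Data.Nat as ℕ using (ℕ; NonZero)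
open import Data.Fin using (Fin)
open import Data.Integer using (+_)
open import Data.Rational using (ℚ; 0ℚ; 1ℚ; _≤_; _*_; _/_)
open import Relation.Binary.PropositionalEquality using (_≢_)

open import Algebra.Bundles using (CommutativeMonoid)
open import Data.Bool using (Bool; true; false; not; _∧_; if_then_else_)
import Data.Bool
open import Data.Fin using (_≟_)
open import Data.Integer as ℤ using ()
import Data.Integer.Properties as ℤ
open import Data.List using (List; []; _∷_; map; concatMap; filter; length; _++_; upTo; applyUpTo; allFin)
open import Data.List.Properties using (map-cong; map-∘; map-applyUpTo)
open import Data.Nat using (zero; suc; z≤n; s≤s)
import Data.Nat.Properties as ℕ
open import Data.Product using (proj₁; proj₂)
open import Data.Rational using (_+_; nonNegative)
open import Data.Rational.Literals using (fromℤ)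
open import Data.Rational.Properties
  using (toℚᵘ-injective; toℚᵘ-fromℚᵘ; toℚᵘ-homo-+; toℚᵘ-homo-*;
         normalize-nonNeg; nonNegative⁻¹; nonNeg*nonNeg⇒nonNeg;
         ≤-refl; ≤-reflexive; ≤-trans; module ≤-Reasoning;
         +-0-commutativeMonoid; +-assoc; +-identityˡ; +-identityʳ; +-mono-≤;
         *-assoc; *-identityʳ; *-zeroʳ; *-distribˡ-+; *-monoˡ-≤-nonNeg)
import Data.Rational.Unnormalised as ℚᵘ
import Data.Rational.Unnormalised.Properties as ℚᵘ
open import Function using (_∘_; id)
open import Relation.Binary.PropositionalEquality using (_≡_; refl; sym; trans; cong; cong₂; module ≡-Reasoning)
open import Relation.Nullary using (Dec; ¬_; yes; no)
open import Relation.Nullary.Decidable using (⌊_⌋; isYes≗does; dec-true; dec-false)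

open import Algebra.Properties.CommutativeSemigroup
  (CommutativeMonoid.commutativeSemigroup +-0-commutativeMonoid) using () renaming (interchange to +-interchange)

-- Unlike + k / 1, fromℤ builds the normal form directly, so toℚᵘ (fromℕ k) computes to mkℚᵘ (+ k) 0.
fromℕ : ℕ → ℚ
fromℕ k = fromℤ (+ k)

fromℕ-+ : ∀ a b → fromℕ (a ℕ.+ b) ≡ fromℕ a + fromℕ b
fromℕ-+ a b = toℚᵘ-injective (ℚᵘ.≃-sym (ℚᵘ.≃-trans (toℚᵘ-homo-+ (fromℕ a) (fromℕ b)) (ℚᵘ.*≡* numerators)))
  where
  numerators : (+ a ℤ.* + 1 ℤ.+ + b ℤ.* + 1) ℤ.* + 1 ≡ + (a ℕ.+ b) ℤ.* + 1
  numerators = cong (ℤ._* + 1)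
    (trans (cong₂ ℤ._+_ (ℤ.*-identityʳ (+ a)) (ℤ.*-identityʳ (+ b))) (sym (ℤ.pos-+ a b)))

fromℕ-mono-≤ : ∀ {a b} → a ℕ.≤ b → fromℕ a ≤ fromℕ b
fromℕ-mono-≤ a≤b = Data.Rational.*≤* (ℤ.*-monoʳ-≤-nonNeg (+ 1) (ℤ.+≤+ a≤b))

*-inverse-fromℕ : ∀ d .{{_ : NonZero d}} → (+ 1 / d) * fromℕ d ≡ 1ℚ
-- + 1 / suc d unfolds to fromℚᵘ of the unnormalised reciprocal mkℚᵘ (+ 1) d of mkℚᵘ (+ suc d) 0.
*-inverse-fromℕ (suc d) = toℚᵘ-injective (ℚᵘ.≃-trans (toℚᵘ-homo-* (+ 1 / suc d) (fromℕ (suc d)))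
  (ℚᵘ.≃-trans (ℚᵘ.*-congʳ (toℚᵘ-fromℚᵘ (ℚᵘ.mkℚᵘ (+ 1) d))) (ℚᵘ.*-inverseˡ (ℚᵘ.mkℚᵘ (+ suc d) 0))))

private
  variable
    A B : Set

∑ : List A → (A → ℚ) → ℚ
∑ xs f = sumℚ (map f xs)

∑-syntax : List A → (A → ℚ) → ℚ
∑-syntax = ∑

infix 5 ∑-syntax
syntax ∑-syntax xs (λ a → f) = ∑[ a ∈ xs ] f

∑-cong : ∀ {f g : A → ℚ} → (∀ a → f a ≡ g a) → ∀ xs → ∑ xs f ≡ ∑ xs g
∑-cong f≗g xs = cong sumℚ (map-cong f≗g xs)

∑-zero : ∀ {f : A → ℚ} → (∀ a → f a ≡ 0ℚ) → ∀ xs → ∑ xs f ≡ 0ℚ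
∑-zero f≗0 []       = refl
∑-zero f≗0 (x ∷ xs) = trans (cong₂ _+_ (f≗0 x) (∑-zero f≗0 xs)) (+-identityʳ 0ℚ)

∑-mono-≤ : ∀ {f g : A → ℚ} → (∀ a → f a ≤ g a) → ∀ xs → ∑ xs f ≤ ∑ xs g
∑-mono-≤ f≤g []       = ≤-refl
∑-mono-≤ f≤g (x ∷ xs) = +-mono-≤ (f≤g x) (∑-mono-≤ f≤g xs)

*-distribˡ-∑ : ∀ p (f : A → ℚ) xs → p * ∑ xs f ≡ ∑[ a ∈ xs ] p * f a
*-distribˡ-∑ p f []       = *-zeroʳ p
*-distribˡ-∑ p f (x ∷ xs) = trans (*-distribˡ-+ p (f x) (∑ xs f)) (cong (_+_ (p * f x)) (*-distribˡ-∑ p f xs))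

∑-distrib-+ : ∀ (f g : A → ℚ) xs → ∑[ a ∈ xs ] f a + g a ≡ ∑ xs f + ∑ xs g
∑-distrib-+ f g []       = sym (+-identityʳ 0ℚ)
∑-distrib-+ f g (x ∷ xs) = trans (cong (_+_ (f x + g x)) (∑-distrib-+ f g xs)) (+-interchange (f x) (g x) _ _)

∑-comm : ∀ (F : A → B → ℚ) xs ys → ∑[ a ∈ xs ] ∑[ b ∈ ys ] F a b ≡ ∑[ b ∈ ys ] ∑[ a ∈ xs ] F a b
∑-comm F []       ys = sym (∑-zero (λ _ → refl) ys)
∑-comm F (x ∷ xs) ys = trans (cong (_+_ (∑ ys (F x))) (∑-comm F xs ys)) (sym (∑-distrib-+ (F x) _ ys))

∑-++ : ∀ (f : A → ℚ) xs ys → ∑ (xs ++ ys) f ≡ ∑ xs f + ∑ ys f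
∑-++ f []       ys = sym (+-identityˡ _)
∑-++ f (x ∷ xs) ys = trans (cong (_+_ (f x)) (∑-++ f xs ys)) (sym (+-assoc (f x) _ _))

∑-map : ∀ (f : B → ℚ) (g : A → B) xs → ∑ (map g xs) f ≡ ∑ xs (f ∘ g)
∑-map f g xs = cong sumℚ (sym (map-∘ xs))

∑-concatMap : ∀ (f : B → ℚ) (g : A → List B) xs → ∑ (concatMap g xs) f ≡ ∑[ a ∈ xs ] ∑ (g a) f
∑-concatMap f g []       = refl
∑-concatMap f g (x ∷ xs) = trans (∑-++ f (g x) (concatMap g xs)) (cong (_+_ (∑ (g x) f)) (∑-concatMap f g xs))

∑-filter : ∀ (P : A → Bool) (f : A → ℚ) xs →
           ∑ (filter (λ a → P a Data.Bool.≟ true) xs) f ≡ ∑[ a ∈ xs ] (if P a then f a else 0ℚ)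
∑-filter P f []       = refl
∑-filter P f (x ∷ xs) with P x
... | true  = cong (_+_ (f x)) (∑-filter P f xs)
... | false = trans (∑-filter P f xs) (sym (+-identityˡ _))

∑-fromℕ : ∀ (d : A → ℕ) xs → ∑[ a ∈ xs ] fromℕ (d a) ≡ fromℕ (sumℕ (map d xs))
∑-fromℕ d []       = refl
∑-fromℕ d (x ∷ xs) = trans (cong (_+_ (fromℕ (d x))) (∑-fromℕ d xs)) (sym (fromℕ-+ (d x) _))

module _ {P : Set} (P? : Dec P) where

  ⌊⌋-true : P → ⌊ P? ⌋ ≡ true
  ⌊⌋-true p = trans (isYes≗does P?) (dec-true P? p)

  ⌊⌋-false : ¬ P → ⌊ P? ⌋ ≡ false
  ⌊⌋-false ¬p = trans (isYes≗does P?) (dec-false P? ¬p)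

incidence : (G : Multigraph) → Fin (n G) → Fin (m G) → ℕ
incidence G w e = 𝟙 ⌊ proj₁ (ends G e) ≟ w ⌋ ℕ.+ 𝟙 ⌊ proj₂ (ends G e) ≟ w ⌋

module _ {G : Multigraph} {w : Fin (n G)} {e : Fin (m G)} where

  incidence-ends₁ : proj₁ (ends G e) ≡ w → 1 ℕ.≤ incidence G w e
  incidence-ends₁ a≡w rewrite ⌊⌋-true (proj₁ (ends G e) ≟ w) a≡w = s≤s z≤n

  incidence-ends₂ : proj₂ (ends G e) ≡ w → 1 ℕ.≤ incidence G w e
  incidence-ends₂ b≡w rewrite ⌊⌋-true (proj₂ (ends G e) ≟ w) b≡w = ℕ.m≤n+m 1 _

module _ {k : ℕ} where

  member-head : ∀ (x : Fin k) ys → member x (x ∷ ys) ≡ true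
  member-head x ys rewrite ⌊⌋-true (x ≟ x) refl = refl

  member-∷ : ∀ {x : Fin k} y {ys} → member x ys ≡ true → member x (y ∷ ys) ≡ true
  member-∷ {x} y x∈ with x ≟ y
  ... | yes _ = refl
  ... | no  _ = x∈

  member-≢ : ∀ {x y : Fin k} {ys} → member x ys ≡ false → member y ys ≡ true → x ≢ y
  member-≢ x∉ y∈ refl with () ← trans (sym x∉) y∈

module Paths (G : Multigraph) (v : Fin (n G)) where

  Vertex : Set
  Vertex = Fin (n G)

  Edge : Set
  Edge = Fin (m G)

  advance : List Vertex → Vertex → Vertex → List Edge → Bool
  advance V x y es = not (member y (x ∷ V)) ∧ isPathFrom G (x ∷ V) y es v

  module _ {V : List Vertex} {x : Vertex} {e : Edge} where

    isPathFrom-∷-ends₁ : x ≡ proj₁ (ends G e) →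
                         ∀ es → isPathFrom G V x (e ∷ es) v ≡ advance V x (proj₂ (ends G e)) es
    isPathFrom-∷-ends₁ x≡a es rewrite ⌊⌋-true (x ≟ proj₁ (ends G e)) x≡a = refl

    isPathFrom-∷-ends₂ : x ≢ proj₁ (ends G e) → x ≡ proj₂ (ends G e) →
                         ∀ es → isPathFrom G V x (e ∷ es) v ≡ advance V x (proj₁ (ends G e)) es
    isPathFrom-∷-ends₂ x≢a x≡b es
      rewrite ⌊⌋-false (x ≟ proj₁ (ends G e)) x≢a | ⌊⌋-true (x ≟ proj₂ (ends G e)) x≡b = refl

    isPathFrom-∷-off : x ≢ proj₁ (ends G e) → x ≢ proj₂ (ends G e) →
                       ∀ es → isPathFrom G V x (e ∷ es) v ≡ false
    isPathFrom-∷-off x≢a x≢b es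
      rewrite ⌊⌋-false (x ≟ proj₁ (ends G e)) x≢a | ⌊⌋-false (x ≟ proj₂ (ends G e)) x≢b = refl

  data FirstEdge (V : List Vertex) (x : Vertex) (e : Edge) : Set where
    dead-end : (∀ es → isPathFrom G V x (e ∷ es) v ≡ false) → FirstEdge V x e
    moves-to : ∀ y → member y (x ∷ V) ≡ false → 1 ℕ.≤ incidence G x e →
               (∀ es → isPathFrom G V x (e ∷ es) v ≡ isPathFrom G (x ∷ V) y es v) → FirstEdge V x e

  moves-to-if-fresh : ∀ {V x e} y → 1 ℕ.≤ incidence G x e →
                      (∀ es → isPathFrom G V x (e ∷ es) v ≡ advance V x y es) → FirstEdge V x e
  moves-to-if-fresh {V} {x} y 1≤inc unfold with member y (x ∷ V) in fresh
  ... | true  = dead-end unfold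
  ... | false = moves-to y fresh 1≤inc unfold

  firstEdge : ∀ V x e → FirstEdge V x e
  firstEdge V x e with x ≟ proj₁ (ends G e) | x ≟ proj₂ (ends G e)
  ... | yes x≡a | _       =
    moves-to-if-fresh _ (incidence-ends₁ {G} {e = e} (sym x≡a)) (isPathFrom-∷-ends₁ x≡a)
  ... | no x≢a  | yes x≡b =
    moves-to-if-fresh _ (incidence-ends₂ {G} {e = e} (sym x≡b)) (isPathFrom-∷-ends₂ x≢a x≡b)
  ... | no x≢a  | no x≢b  = dead-end (isPathFrom-∷-off x≢a x≢b)

  isPathFrom-revisit : ∀ V x → member v (x ∷ V) ≡ true → ∀ e es → isPathFrom G V x (e ∷ es) v ≡ false
  isPathFrom-revisit V x v∈ e es with firstEdge V x e
  ... | dead-end blocked         = blocked es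
  ... | moves-to y y∉ _ unfold = trans (unfold es) (from-y es)
    where
    from-y : ∀ fs → isPathFrom G (x ∷ V) y fs v ≡ false
    from-y []       = ⌊⌋-false (y ≟ v) (member-≢ {ys = x ∷ V} y∉ v∈)
    from-y (f ∷ fs) = isPathFrom-revisit (x ∷ V) y (member-∷ {x = v} y {x ∷ V} v∈) f fs

  module Weighted (X : ℚ) where

    weight : List Vertex → Vertex → List Edge → ℚ
    weight V x es = if isPathFrom G V x es v then X ^ℚ length es else 0ℚ

    pathSumBelow : List Vertex → Vertex → ℕ → ℚ
    pathSumBelow V x L = ∑[ k ∈ upTo L ] ∑[ es ∈ edgeSeqs G k ] weight V x es

    pathSumVia : List Vertex → Vertex → Edge → ℕ → ℚ
    pathSumVia V x e L = ∑[ k ∈ upTo L ] ∑[ es ∈ edgeSeqs G k ] weight V x (e ∷ es)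

    pathSum≡pathSumBelow : ∀ u → pathSum G u v X ≡ pathSumBelow [] u (suc (n G))
    pathSum≡pathSumBelow u = trans (∑-concatMap power pathsOfLength (upTo (suc (n G))))
      (∑-cong (λ k → ∑-filter (isPath G u v) power (edgeSeqs G k)) (upTo (suc (n G))))
      where
      power : List Edge → ℚ
      power P = X ^ℚ length P
      pathsOfLength : ℕ → List (List Edge)
      pathsOfLength k = filter (λ es → isPath G u v es Data.Bool.≟ true) (edgeSeqs G k)

    pathSumBelow-suc : ∀ V x L →
                       pathSumBelow V x (suc L) ≡ weight V x [] + (∑[ e ∈ allFin (m G) ] pathSumVia V x e L)
    pathSumBelow-suc V x L = begin
      (weight V x [] + 0ℚ) + ∑ (applyUpTo suc L) S
        ≡⟨ cong₂ _+_ (+-identityʳ (weight V x [])) shift ⟩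
      weight V x [] + (∑[ k ∈ upTo L ] S (suc k))
        ≡⟨ cong (_+_ (weight V x [])) (∑-cong split (upTo L)) ⟩
      weight V x [] + (∑[ k ∈ upTo L ] ∑[ e ∈ allFin (m G) ] ∑[ es ∈ edgeSeqs G k ] weight V x (e ∷ es))
        ≡⟨ cong (_+_ (weight V x [])) (∑-comm _ (upTo L) (allFin (m G))) ⟩
      weight V x [] + (∑[ e ∈ allFin (m G) ] pathSumVia V x e L)
        ∎
      where
      open ≡-Reasoning
      S : ℕ → ℚ
      S k = ∑[ es ∈ edgeSeqs G k ] weight V x es
      shift : ∑ (applyUpTo suc L) S ≡ ∑ (upTo L) (S ∘ suc)
      shift = cong sumℚ (trans (map-applyUpTo suc S L) (sym (map-applyUpTo id (S ∘ suc) L)))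
      split : ∀ k → S (suc k) ≡ ∑[ e ∈ allFin (m G) ] ∑[ es ∈ edgeSeqs G k ] weight V x (e ∷ es)
      split k = trans (∑-concatMap (weight V x) _ (allFin (m G)))
        (∑-cong (λ e → ∑-map (weight V x) (e ∷_) (edgeSeqs G k)) (allFin (m G)))

    weight-false : ∀ V x es → isPathFrom G V x es v ≡ false → weight V x es ≡ 0ℚ
    weight-false V x es eq rewrite eq = refl

    weight-∷ : ∀ V x e es W y → isPathFrom G V x (e ∷ es) v ≡ isPathFrom G W y es v →
               weight V x (e ∷ es) ≡ X * weight W y es
    weight-∷ V x e es W y eq rewrite eq with isPathFrom G W y es v
    ... | true  = refl
    ... | false = sym (*-zeroʳ X)

    pathSumVia-dead-end : ∀ V x e → (∀ es → isPathFrom G V x (e ∷ es) v ≡ false) →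
                          ∀ L → pathSumVia V x e L ≡ 0ℚ
    pathSumVia-dead-end V x e blocked L =
      ∑-zero (λ k → ∑-zero (λ es → weight-false V x (e ∷ es) (blocked es)) (edgeSeqs G k)) (upTo L)

    pathSumVia-moves-to : ∀ V x e W y → (∀ es → isPathFrom G V x (e ∷ es) v ≡ isPathFrom G W y es v) →
                          ∀ L → pathSumVia V x e L ≡ X * pathSumBelow W y L
    pathSumVia-moves-to V x e W y unfold L = begin
      pathSumVia V x e L
        ≡⟨ ∑-cong (λ k → ∑-cong (λ es → weight-∷ V x e es W y (unfold es)) (edgeSeqs G k)) (upTo L) ⟩
      ∑[ k ∈ upTo L ] ∑[ es ∈ edgeSeqs G k ] X * weight W y es
        ≡⟨ ∑-cong (λ k → sym (*-distribˡ-∑ X (weight W y) (edgeSeqs G k))) (upTo L) ⟩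
      ∑[ k ∈ upTo L ] X * (∑[ es ∈ edgeSeqs G k ] weight W y es)
        ≡⟨ sym (*-distribˡ-∑ X _ (upTo L)) ⟩
      X * pathSumBelow W y L
        ∎
      where open ≡-Reasoning

    pathSumBelow-target : ∀ V L → pathSumBelow V v (suc L) ≡ 1ℚ
    pathSumBelow-target V L = begin
      pathSumBelow V v (suc L)
        ≡⟨ pathSumBelow-suc V v L ⟩
      weight V v [] + (∑[ e ∈ allFin (m G) ] pathSumVia V v e L)
        ≡⟨ cong₂ _+_ (cong (if_then 1ℚ else 0ℚ) (⌊⌋-true (v ≟ v) refl)) (∑-zero revisits (allFin (m G))) ⟩
      1ℚ + 0ℚ
        ≡⟨ +-identityʳ 1ℚ ⟩
      1ℚ
        ∎
      where
      open ≡-Reasoning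
      revisits : ∀ e → pathSumVia V v e L ≡ 0ℚ
      revisits e = pathSumVia-dead-end V v e (isPathFrom-revisit V v (member-head v V) e) L

    module _ (0≤X : 0ℚ ≤ X) where

      X*-mono-≤ : ∀ {p q} → p ≤ q → X * p ≤ X * q
      X*-mono-≤ = *-monoˡ-≤-nonNeg X {{nonNegative 0≤X}}

      pathSumVia-≤ : ∀ L → (∀ W y → pathSumBelow W y L ≤ 1ℚ) →
                     ∀ V x e → pathSumVia V x e L ≤ X * fromℕ (incidence G x e)
      pathSumVia-≤ L IH V x e with firstEdge V x e
      ... | dead-end blocked = begin
        pathSumVia V x e L            ≡⟨ pathSumVia-dead-end V x e blocked L ⟩
        0ℚ                            ≡⟨ sym (*-zeroʳ X) ⟩
        X * fromℕ 0                   ≤⟨ X*-mono-≤ (fromℕ-mono-≤ z≤n) ⟩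
        X * fromℕ (incidence G x e)   ∎
        where open ≤-Reasoning
      ... | moves-to y _ 1≤inc unfold = begin
        pathSumVia V x e L            ≡⟨ pathSumVia-moves-to V x e (x ∷ V) y unfold L ⟩
        X * pathSumBelow (x ∷ V) y L  ≤⟨ X*-mono-≤ (IH (x ∷ V) y) ⟩
        X * fromℕ 1                   ≤⟨ X*-mono-≤ (fromℕ-mono-≤ 1≤inc) ⟩
        X * fromℕ (incidence G x e)   ∎
        where open ≤-Reasoning

      module _ {Δ : ℕ} (degree≤Δ : ∀ w → w ≢ v → degree G w ℕ.≤ Δ) where

        pathSumBelow-suc-≤ : ∀ L → (∀ W y → pathSumBelow W y L ≤ 1ℚ) →
                             ∀ V x → x ≢ v → pathSumBelow V x (suc L) ≤ X * fromℕ Δ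
        pathSumBelow-suc-≤ L IH V x x≢v = begin
          pathSumBelow V x (suc L)
            ≡⟨ pathSumBelow-suc V x L ⟩
          weight V x [] + (∑[ e ∈ allFin (m G) ] pathSumVia V x e L)
            ≡⟨ cong (_+ (∑[ e ∈ allFin (m G) ] pathSumVia V x e L)) not-at-target ⟩
          0ℚ + (∑[ e ∈ allFin (m G) ] pathSumVia V x e L)
            ≡⟨ +-identityˡ _ ⟩
          ∑[ e ∈ allFin (m G) ] pathSumVia V x e L
            ≤⟨ ∑-mono-≤ (pathSumVia-≤ L IH V x) (allFin (m G)) ⟩
          ∑[ e ∈ allFin (m G) ] X * fromℕ (incidence G x e)
            ≡⟨ sym (*-distribˡ-∑ X (fromℕ ∘ incidence G x) (allFin (m G))) ⟩
          X * (∑[ e ∈ allFin (m G) ] fromℕ (incidence G x e))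
            ≡⟨ cong (X *_) (∑-fromℕ (incidence G x) (allFin (m G))) ⟩
          X * fromℕ (degree G x)
            ≤⟨ X*-mono-≤ (fromℕ-mono-≤ (degree≤Δ x x≢v)) ⟩
          X * fromℕ Δ
            ∎
          where
          open ≤-Reasoning
          not-at-target : weight V x [] ≡ 0ℚ
          not-at-target = weight-false V x [] (⌊⌋-false (x ≟ v) x≢v)

        pathSumBelow-≤1 : X * fromℕ Δ ≤ 1ℚ → ∀ L V x → pathSumBelow V x L ≤ 1ℚ
        pathSumBelow-≤1 XΔ≤1 zero    V x = fromℕ-mono-≤ z≤n
        pathSumBelow-≤1 XΔ≤1 (suc L) V x = byTarget (x ≟ v)
          where
          byTarget : Dec (x ≡ v) → pathSumBelow V x (suc L) ≤ 1ℚ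
          byTarget (yes x≡v) =
            ≤-reflexive (trans (cong (λ y → pathSumBelow V y (suc L)) x≡v) (pathSumBelow-target V L))
          byTarget (no x≢v)  = ≤-trans (pathSumBelow-suc-≤ L (pathSumBelow-≤1 XΔ≤1 L) V x x≢v) XΔ≤1

lemma4p1 : (G : Multigraph) (v : Fin (n G)) (Δ : ℕ) .{{_ : NonZero Δ}} →
           (∀ (w : Fin (n G)) → w ≢ v → degree G w ℕ.≤ Δ) →
           (u : Fin (n G)) → u ≢ v →
           (c : ℚ) → 0ℚ ≤ c → c ≤ 1ℚ →
           pathSum G u v (c * (+ 1 / Δ)) ≤ c
lemma4p1 G v Δ degree≤Δ u u≢v c 0≤c c≤1 = begin
  pathSum G u v X                ≡⟨ pathSum≡pathSumBelow u ⟩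
  pathSumBelow [] u (suc (n G))  ≤⟨ pathSumBelow-suc-≤ 0≤X degree≤Δ (n G) shorter≤1 [] u u≢v ⟩
  X * fromℕ Δ                    ≡⟨ XΔ≡c ⟩
  c                              ∎
  where
  open ≤-Reasoning
  X : ℚ
  X = c * (+ 1 / Δ)
  open Paths G v
  open Weighted X
  0≤X : 0ℚ ≤ X
  0≤X = nonNegative⁻¹ X {{nonNeg*nonNeg⇒nonNeg c {{nonNegative 0≤c}} (+ 1 / Δ) {{normalize-nonNeg 1 Δ}}}}
  XΔ≡c : X * fromℕ Δ ≡ c
  XΔ≡c = trans (*-assoc c (+ 1 / Δ) (fromℕ Δ)) (trans (cong (c *_) (*-inverse-fromℕ Δ)) (*-identityʳ c))
  XΔ≤1 : X * fromℕ Δ ≤ 1ℚ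
  XΔ≤1 = ≤-trans (≤-reflexive XΔ≡c) c≤1
  shorter≤1 : ∀ W y → pathSumBelow W y (n G) ≤ 1ℚ
  shorter≤1 = pathSumBelow-≤1 0≤X degree≤Δ XΔ≤1 (n G)
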